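{- Fix a prime $p$, an integer $k\ge0$, a sign $\pm$ and positive integers $f,l$. For $m\in\mathbb{Z}$ let $\mathbf{1}_f(m)=1$ if $f^2\mid m^2\mp4p^k$ and $(m^2\mp4p^k)/f^2\equiv0$ or $1\pmod4$, and $\mathbf{1}_f(m)=0$ otherwise. If $m_1\equiv m_2\pmod{lf^2}$, then \[ \mathbf{1}_f(m_1)\Big(\frac{(m_1^2\mp4p^k)/f^2}{l}\Big)=\mathbf{1}_f(m_2)\Big(\frac{(m_2^2\mp4p^k)/f^2}{l}\Big), \] where $\big(\frac{\cdot}{l}\big)$ is the Kronecker symbol.
   Context: By convention the product $\mathbf{1}_f(m)\big(\frac{(m^2\mp4p^k)/f^2}{l}\big)$ is $0$ whenever $\mathbf{1}_f(m)=0$ (the Kronecker symbol is only evaluated when its upper entry is an integer). -}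

module Defs where

open import Data.Bool using (Bool; true; false; if_then_else_; _∨_)
open import Data.Nat as ℕ using (ℕ; zero; suc)
open import Data.Nat.Divisibility as ℕD using ()
open import Data.Integer as ℤ using (ℤ; +_; -[1+_]; ∣_∣; _*_; _-_; _+_; -_; 0ℤ; 1ℤ)
open import Data.Integer.DivMod using (_/ℕ_; _%ℕ_)
open import Data.Integer.Divisibility using (_∣_)
open import Data.List using (List; upTo)
open import Data.Bool.ListAction using (any)
open import Relation.Nullary using (Dec; yes; no; does)

-- decidable divisibility on ℤ (the library's ℤ._∣_ is ℕ._∣_ on absolute values)
_∣ℤ?_ : (d a : ℤ) → Dec (d ∣ a)
d ∣ℤ? a = ∣ d ∣ ℕD.∣? ∣ a ∣

_≡ᵇ_ : ℕ → ℕ → Bool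
m ≡ᵇ n = does (m ℕ.≟ n)

-- smallest divisor d ≥ start of n (searching with fuel); for n ≥ 2,
-- spf n = smallestDivFrom n 2 n is the smallest prime factor of n.
smallestDivFrom : ℕ → ℕ → ℕ → ℕ
smallestDivFrom zero    d n = n
smallestDivFrom (suc f) d n = if does (d ℕD.∣? n) then d else smallestDivFrom f (suc d) n

spf : ℕ → ℕ
spf n = smallestDivFrom n 2 n

legendre : ℤ → ℕ → ℤ
legendre a q with (+ q) ∣ℤ? a
... | yes _ = 0ℤ
... | no  _ = if any (λ x → does ((+ q) ∣ℤ? ((+ x) * (+ x) - a))) (upTo q)
                then 1ℤ else - 1ℤ

kron2 : ℤ → ℤ
kron2 a with a %ℕ 2
... | 0 = 0ℤ
... | _ with a %ℕ 8
...   | r = if (r ≡ᵇ 1) ∨ (r ≡ᵇ 7) then 1ℤ else - 1ℤ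

primeSym : ℤ → ℕ → ℤ
primeSym a 2 = kron2 a
primeSym a q = legendre a q

-- Kronecker symbol with fuel: multiplicativity in the lower argument,
-- peeling off the smallest prime factor.  Fuel n suffices for (a/n).
kronF : ℕ → ℤ → ℕ → ℤ
kronF zero    a n = 1ℤ
kronF (suc f) a zero = if (∣ a ∣ ≡ᵇ 1) then 1ℤ else 0ℤ
kronF (suc f) a (suc zero) = 1ℤ
kronF (suc f) a (suc (suc n)) = step (spf (suc (suc n)))
  where
  step : ℕ → ℤ
  step zero    = 0ℤ
  step (suc q) = primeSym a (suc q) * kronF f a (suc (suc n) ℕ./ suc q)

kronecker : ℤ → ℕ → ℤ
kronecker a n = kronF n a n

data PM : Set where
  minus plus : PM

disc : PM → ℕ → ℕ → ℤ → ℤ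
disc minus p k m = m * m - (+ (4 ℕ.* p ℕ.^ k))
disc plus  p k m = m * m + (+ (4 ℕ.* p ℕ.^ k))

-- exact quotient a / f² (f = 0 is never used)
divSq : ℤ → ℕ → ℤ
divSq a zero    = 0ℤ
divSq a (suc g) = a /ℕ (suc g ℕ.* suc g)

indicator : PM → ℕ → ℕ → (f : ℕ) → ℤ → ℤ
indicator s p k f m with (+ (f ℕ.* f)) ∣ℤ? disc s p k m
... | no _ = 0ℤ
... | yes _ with (divSq (disc s p k m) f) %ℕ 4
...   | r = if (r ≡ᵇ 0) ∨ (r ≡ᵇ 1) then 1ℤ else 0ℤ

term : PM → ℕ → ℕ → (f : ℕ) → ℕ → ℤ → ℤ
term s p k f l m with (+ (f ℕ.* f)) ∣ℤ? disc s p k m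
... | no _ = 0ℤ
... | yes _ = indicator s p k f m * kronecker (divSq (disc s p k m) f) l

-- Put F = f² and Dᵢ = mᵢ² + δ with δ = ∓4pᵏ. Since m₁ ≡ m₂ (mod lF), D₁ ≡ D₂ (mod F), so
-- F divides both or neither. When it divides both, the quotients aᵢ = Dᵢ/F satisfy
-- a₂ − a₁ = c·l·(m₁ + m₂), whence a₁ ≡ a₂ (mod l): this fixes every Legendre factor of the
-- Kronecker symbol and, for l even, the parity entering (·/2). If f is odd,
-- F ≡ 1 (mod 4) and aᵢ ≡ mᵢ² ≡ 0 or 1 (mod 4), so both indicators are 1. If f is even, m₁ is even
-- and 4 ∣ m₁ + m₂, so a₁ ≡ a₂ (mod 4). If l is even and a₁ is odd, then m₁ ≡ F (mod 2), which
-- makes c·l·(m₁ + m₂) divisible by 8, as the factor (·/2) requires.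

module Submission where

open import Data.Bool using (if_then_else_; _∨_)
open import Data.Bool.ListAction using (or)
open import Data.Empty using (⊥-elim)
open import Data.Integer as ℤ using (ℤ; +_; ∣_∣; _*_; _-_; _+_; -_; 0ℤ; 1ℤ)
open import Data.Integer.DivMod using (_%ℕ_; _/ℕ_; n%ℕd<d; a≡a%ℕn+[a/ℕn]*n)
import Data.Integer.Divisibility as Unsigned
open import Data.Integer.Divisibility.Signed
  using (_∣_; divides; ∣⇒∣ᵤ; ∣ᵤ⇒∣; ∣-trans; ∣m∣n⇒∣m+n; ∣m⇒∣-m; ∣n⇒∣m*n; ∣m⇒∣m*n; *-monoʳ-∣)
open import Data.Integer.Properties
  using ( i-j≡0⇒i≡j; ∣i∣≡0⇒i≡0; +-injective; m-n≡m⊖n; ∣m⊝n∣≤m⊔n; pos-*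
        ; +-identityˡ; +-identityʳ; *-identityˡ; *-identityʳ; *-zeroʳ; *-cancelʳ-≡)
open import Data.Integer.Tactic.RingSolver using (solve; solve-∀)
open import Data.List using ([]; _∷_; upTo)
open import Data.List.Properties using (map-cong)
open import Data.Nat as ℕ using (ℕ; zero; suc; NonZero)
import Data.Nat.Divisibility as ℕ
import Data.Nat.Properties as ℕ
open import Data.Nat.Primality using (Prime)
open import Data.Product using (Σ; _,_; proj₁; proj₂)
open import Data.Sum using (_⊎_; inj₁; inj₂)
open import Function.Base using (_∘′_)
open import Function.Bundles using (mk⇔)
open import Relation.Binary.Bundles using (Setoid)
open import Relation.Binary.PropositionalEquality
  using (_≡_; refl; sym; trans; cong; cong₂; subst; subst₂; module ≡-Reasoning)
import Relation.Binary.Reasoning.Setoid as SetoidReasoning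
open import Relation.Binary.Structures using (IsEquivalence)
open import Relation.Nullary using (¬_; Dec; yes; no; does)
open import Relation.Nullary.Decidable using (does-⇔)

open import Defs

infix 4 _≡_mod_

-- A record rather than a synonym for + n ∣ a - b, so that a, b and n can be inferred.

record _≡_mod_ (a b : ℤ) (n : ℕ) : Set where
  constructor ∣⇒mod
  field mod⇒∣ : + n ∣ a - b

open _≡_mod_ public

module _ {n : ℕ} where

  mod-refl : ∀ a → a ≡ a mod n
  mod-refl a = ∣⇒mod (divides 0ℤ (a-a≡0 a))
    where
    a-a≡0 : ∀ a → a - a ≡ 0ℤ * + n
    a-a≡0 = solve-∀

  mod-sym : ∀ {a b} → a ≡ b mod n → b ≡ a mod n
  mod-sym {a} {b} (∣⇒mod n∣a-b) = ∣⇒mod (subst (+ n ∣_) (negate a b) (∣m⇒∣-m n∣a-b))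
    where
    negate : ∀ a b → - (a - b) ≡ b - a
    negate = solve-∀

  mod-trans : ∀ {a b c} → a ≡ b mod n → b ≡ c mod n → a ≡ c mod n
  mod-trans {a} {b} {c} (∣⇒mod n∣a-b) (∣⇒mod n∣b-c) =
    ∣⇒mod (subst (+ n ∣_) (telescope a b c) (∣m∣n⇒∣m+n n∣a-b n∣b-c))
    where
    telescope : ∀ a b c → (a - b) + (b - c) ≡ a - c
    telescope = solve-∀

  +-cong-mod : ∀ {a b c d} → a ≡ b mod n → c ≡ d mod n → a + c ≡ b + d mod n
  +-cong-mod {a} {b} {c} {d} (∣⇒mod n∣a-b) (∣⇒mod n∣c-d) =
    ∣⇒mod (subst (+ n ∣_) (regroup a b c d) (∣m∣n⇒∣m+n n∣a-b n∣c-d))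
    where
    regroup : ∀ a b c d → (a - b) + (c - d) ≡ (a + c) - (b + d)
    regroup = solve-∀

  neg-cong-mod : ∀ {a b} → a ≡ b mod n → - a ≡ - b mod n
  neg-cong-mod {a} {b} (∣⇒mod n∣a-b) = ∣⇒mod (subst (+ n ∣_) (negate a b) (∣m⇒∣-m n∣a-b))
    where
    negate : ∀ a b → - (a - b) ≡ - a - - b
    negate = solve-∀

  *-cong-mod : ∀ {a b c d} → a ≡ b mod n → c ≡ d mod n → a * c ≡ b * d mod n
  *-cong-mod {a} {b} {c} {d} (∣⇒mod n∣a-b) (∣⇒mod n∣c-d) =
    ∣⇒mod (subst (+ n ∣_) (regroup a b c d) (∣m∣n⇒∣m+n (∣m⇒∣m*n c n∣a-b) (∣n⇒∣m*n b n∣c-d)))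
    where
    regroup : ∀ a b c d → (a - b) * c + b * (c - d) ≡ a * c - b * d
    regroup = solve-∀

  multiple≡0 : ∀ q → q * + n ≡ 0ℤ mod n
  multiple≡0 q = ∣⇒mod (divides q (+-identityʳ (q * + n)))

  mod-isEquivalence : IsEquivalence (λ a b → a ≡ b mod n)
  mod-isEquivalence = record
    { refl  = λ {a} → mod-refl a
    ; sym   = λ {a} {b} → mod-sym {a} {b}
    ; trans = λ {a} {b} {c} → mod-trans {a} {b} {c}
    }

mod-setoid : ℕ → Setoid _ _
mod-setoid n = record { isEquivalence = mod-isEquivalence {n} }

module ModReasoning (n : ℕ) = SetoidReasoning (mod-setoid n)

mod-weaken : ∀ {d n a b} → d ℕ.∣ n → a ≡ b mod n → a ≡ b mod d
mod-weaken {d} {n} d∣n (∣⇒mod n∣a-b) = ∣⇒mod (∣-trans (∣ᵤ⇒∣ {+ d} {+ n} d∣n) n∣a-b)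

*-scale-mod : ∀ k {n a b} → a ≡ b mod n → + k * a ≡ + k * b mod (k ℕ.* n)
*-scale-mod k {n} {a} {b} (∣⇒mod n∣a-b) =
  ∣⇒mod (subst₂ _∣_ (sym (pos-* k n)) (distrib (+ k) a b) (*-monoʳ-∣ (+ k) n∣a-b))
  where
  distrib : ∀ k a b → k * (a - b) ≡ k * a - k * b
  distrib = solve-∀

∣⇒≡0-mod : ∀ {n a} → + n ∣ a → a ≡ 0ℤ mod n
∣⇒≡0-mod {n} {a} n∣a = ∣⇒mod (subst (+ n ∣_) (sym (+-identityʳ a)) n∣a)

∣ᵤ⇒mod : ∀ {n} a b → + n Unsigned.∣ a - b → a ≡ b mod n
∣ᵤ⇒mod {n} a b = ∣⇒mod ∘′ ∣ᵤ⇒∣ {+ n} {a - b}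

mod-%ℕ : ∀ a n .{{_ : NonZero n}} → a ≡ + (a %ℕ n) mod n
mod-%ℕ a n = subst (λ x → x ≡ + (a %ℕ n) mod n) (sym (a≡a%ℕn+[a/ℕn]*n a n))
  (∣⇒mod (divides (a /ℕ n) (cancel (+ (a %ℕ n)) (a /ℕ n * + n))))
  where
  cancel : ∀ r x → r + x - r ≡ x
  cancel = solve-∀

residue-unique : ∀ {n r s} → r ℕ.< n → s ℕ.< n → + r ≡ + s mod n → r ≡ s
residue-unique {n} {r} {s} r<n s<n r≡s = +-injective (i-j≡0⇒i≡j _ _ (∣i∣≡0⇒i≡0 distance≡0))
  where
  distance<n : ∣ + r - + s ∣ ℕ.< n
  distance<n = ℕ.≤-<-trans (subst (ℕ._≤ r ℕ.⊔ s) (cong ∣_∣ (sym (m-n≡m⊖n r s))) (∣m⊝n∣≤m⊔n r s))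
                           (ℕ.⊔-pres-<m r<n s<n)
  distance≡0 : ∣ + r - + s ∣ ≡ 0
  distance≡0 with ∣ + r - + s ∣ | ∣⇒∣ᵤ (mod⇒∣ r≡s) | distance<n
  ... | zero  | _   | _   = refl
  ... | suc _ | n∣d | d<n = ⊥-elim (ℕ.>⇒∤ d<n n∣d)

%ℕ-cong : ∀ {a b} n .{{_ : NonZero n}} → a ≡ b mod n → a %ℕ n ≡ b %ℕ n
%ℕ-cong {a} {b} n a≡b = residue-unique (n%ℕd<d a n) (n%ℕd<d b n)
  (mod-trans (mod-sym (mod-%ℕ a n)) (mod-trans a≡b (mod-%ℕ b n)))

mod⇒multiple : ∀ {a b n} → a ≡ b mod n → Σ ℤ λ q → a ≡ b + q * + n
mod⇒multiple {a} {b} (∣⇒mod (divides q a-b≡qn)) = q , (begin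
  a             ≡⟨ shift a b ⟩
  b + (a - b)   ≡⟨ cong (_+_ b) a-b≡qn ⟩
  b + q * + _   ∎)
  where
  open ≡-Reasoning
  shift : ∀ a b → a ≡ b + (a - b)
  shift = solve-∀

parity : ∀ x → x ≡ 0ℤ mod 2 ⊎ x ≡ 1ℤ mod 2
parity x with x %ℕ 2 | n%ℕd<d x 2 | mod-%ℕ x 2
... | 0           | _                | x≡0 = inj₁ x≡0
... | 1           | _                | x≡1 = inj₂ x≡1
... | suc (suc _) | ℕ.s≤s (ℕ.s≤s ()) | _

square-mod2 : ∀ x → x * x ≡ x mod 2
square-mod2 x with parity x
... | inj₁ x≡0 = mod-trans (*-cong-mod x≡0 x≡0) (mod-sym x≡0)
... | inj₂ x≡1 = mod-trans (*-cong-mod x≡1 x≡1) (mod-sym x≡1)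

even-square : ∀ {x} → x ≡ 0ℤ mod 2 → x * x ≡ 0ℤ mod 4
even-square x≡0 with mod⇒multiple x≡0
... | t , refl = ∣⇒mod (divides (t * t) (expand t))
  where
  expand : ∀ t → (0ℤ + t * + 2) * (0ℤ + t * + 2) - 0ℤ ≡ t * t * + 4
  expand = solve-∀

odd-square : ∀ {x} → x ≡ 1ℤ mod 2 → x * x ≡ 1ℤ mod 4
odd-square x≡1 with mod⇒multiple x≡1
... | t , refl = ∣⇒mod (divides (t * t + t) (expand t))
  where
  expand : ∀ t → (1ℤ + t * + 2) * (1ℤ + t * + 2) - 1ℤ ≡ (t * t + t) * + 4
  expand = solve-∀

square-mod4 : ∀ x → x * x ≡ 0ℤ mod 4 ⊎ x * x ≡ 1ℤ mod 4
square-mod4 x with parity x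
... | inj₁ x≡0 = inj₁ (even-square x≡0)
... | inj₂ x≡1 = inj₂ (odd-square x≡1)

1≢0-mod4 : ¬ (1ℤ ≡ 0ℤ mod 4)
1≢0-mod4 1≡0 with %ℕ-cong 4 1≡0
... | ()

product-even : ∀ {m F} x → m ≡ F mod 2 → x * (m + x * F) ≡ 0ℤ mod 2
product-even {m} {F} x m≡F = begin
  x * (m + x * F)    ≈⟨ *-cong-mod (mod-refl x) (+-cong-mod m≡F (mod-refl (x * F))) ⟩
  x * (F + x * F)    ≡⟨ regroup x F ⟩
  F * (x + x * x)    ≈⟨ *-cong-mod (mod-refl F) (+-cong-mod (mod-refl x) (square-mod2 x)) ⟩
  F * (x + x)        ≡⟨ double x F ⟩
  (F * x) * + 2      ≈⟨ multiple≡0 (F * x) ⟩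
  0ℤ                 ∎
  where
  open ModReasoning 2
  regroup : ∀ x F → x * (F + x * F) ≡ F * (x + x * x)
  regroup = solve-∀
  double : ∀ x F → F * (x + x) ≡ (F * x) * + 2
  double = solve-∀

∣-resp-mod : ∀ {n a b} → a ≡ b mod n → + n Unsigned.∣ a → + n Unsigned.∣ b
∣-resp-mod {n} {a} {b} a≡b n∣a = ∣⇒∣ᵤ (subst (+ n ∣_) (+-identityʳ b)
  (mod⇒∣ (mod-trans (mod-sym a≡b) (∣⇒≡0-mod (∣ᵤ⇒∣ {+ n} {a} n∣a)))))

∣ℤ?-cong : ∀ {n a b} → a ≡ b mod n → does ((+ n) ∣ℤ? a) ≡ does ((+ n) ∣ℤ? b)
∣ℤ?-cong {n} {a} {b} a≡b =
  does-⇔ (mk⇔ (∣-resp-mod a≡b) (∣-resp-mod (mod-sym a≡b))) ((+ n) ∣ℤ? a) ((+ n) ∣ℤ? b)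

legendre-cong : ∀ q {a b} → a ≡ b mod q → legendre a q ≡ legendre b q
legendre-cong q {a} {b} a≡b with (+ q) ∣ℤ? a | (+ q) ∣ℤ? b
... | yes _   | yes _   = refl
... | yes q∣a | no  q∤b = ⊥-elim (q∤b (∣-resp-mod a≡b q∣a))
... | no  q∤a | yes q∣b = ⊥-elim (q∤a (∣-resp-mod (mod-sym a≡b) q∣b))
... | no  _   | no  _   = cong (λ t → if t then 1ℤ else - 1ℤ) (cong or (map-cong same-roots (upTo q)))
  where
  same-roots : ∀ x → does ((+ q) ∣ℤ? (+ x * + x - a)) ≡ does ((+ q) ∣ℤ? (+ x * + x - b))
  same-roots x = ∣ℤ?-cong {q} {+ x * + x - a} (+-cong-mod (mod-refl (+ x * + x)) (neg-cong-mod a≡b))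

kron2-of-residues : ℕ → ℕ → ℤ
kron2-of-residues zero    _ = 0ℤ
kron2-of-residues (suc _) r = if (r ≡ᵇ 1) ∨ (r ≡ᵇ 7) then 1ℤ else - 1ℤ

kron2≡kron2-of-residues : ∀ a → kron2 a ≡ kron2-of-residues (a %ℕ 2) (a %ℕ 8)
kron2≡kron2-of-residues a with a %ℕ 2
... | zero  = refl
... | suc _ = refl

kron2-cong : ∀ {a b} → a ≡ b mod 2 → (a ≡ 1ℤ mod 2 → a ≡ b mod 8) → kron2 a ≡ kron2 b
kron2-cong {a} {b} a≡b odd⇒a≡b = begin
  kron2 a                               ≡⟨ kron2≡kron2-of-residues a ⟩
  kron2-of-residues (a %ℕ 2) (a %ℕ 8)   ≡⟨ residues-agree (parity a) ⟩
  kron2-of-residues (b %ℕ 2) (b %ℕ 8)   ≡⟨ kron2≡kron2-of-residues b ⟨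
  kron2 b                               ∎
  where
  open ≡-Reasoning
  residues-agree : a ≡ 0ℤ mod 2 ⊎ a ≡ 1ℤ mod 2
                 → kron2-of-residues (a %ℕ 2) (a %ℕ 8) ≡ kron2-of-residues (b %ℕ 2) (b %ℕ 8)
  residues-agree (inj₁ a≡0) =
    trans (cong (λ r → kron2-of-residues r (a %ℕ 8)) (%ℕ-cong 2 a≡0))
          (cong (λ r → kron2-of-residues r (b %ℕ 8)) (%ℕ-cong 2 (mod-trans (mod-sym a≡0) a≡b)))
  residues-agree (inj₂ a≡1) = cong₂ kron2-of-residues (%ℕ-cong 2 a≡b) (%ℕ-cong 8 (odd⇒a≡b a≡1))

primeSym-cong : ∀ q {a b} → a ≡ b mod q → (q ≡ 2 → a ≡ 1ℤ mod 2 → a ≡ b mod 8)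
              → primeSym a q ≡ primeSym b q
primeSym-cong 0                     a≡b _       = legendre-cong 0 a≡b
primeSym-cong 1                     a≡b _       = legendre-cong 1 a≡b
primeSym-cong 2                     a≡b odd⇒a≡b = kron2-cong a≡b (odd⇒a≡b refl)
primeSym-cong q@(suc (suc (suc _))) a≡b _       = legendre-cong q a≡b

smallestDivFrom-∣ : ∀ fuel d n → smallestDivFrom fuel d n ℕ.∣ n
smallestDivFrom-∣ zero       d n = ℕ.∣-refl
smallestDivFrom-∣ (suc fuel) d n with d ℕ.∣? n
... | yes d∣n = d∣n
... | no  _   = smallestDivFrom-∣ fuel (suc d) n

kronF-cong : ∀ {a b l} .{{_ : NonZero l}} → (∀ q → q ℕ.∣ l → primeSym a q ≡ primeSym b q)
           → ∀ fuel n → n ℕ.∣ l → kronF fuel a n ≡ kronF fuel b n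
kronF-cong         same zero       n               _   = refl
kronF-cong {l = l} same (suc fuel) zero            0∣l = ⊥-elim (ℕ.≢-nonZero⁻¹ l (ℕ.0∣⇒≡0 0∣l))
kronF-cong         same (suc fuel) (suc zero)      _   = refl
kronF-cong         same (suc fuel) n@(suc (suc _)) n∣l with spf n | smallestDivFrom-∣ n 2 n
... | zero  | _   = refl
... | suc q | q∣n = cong₂ _*_ (same (suc q) (ℕ.∣-trans q∣n n∣l))
                              (kronF-cong same fuel _ (ℕ.∣-trans (ℕ.m/n∣m q∣n) n∣l))

kronecker-cong : ∀ l {a b} → a ≡ b mod l → (2 ℕ.∣ l → a ≡ 1ℤ mod 2 → a ≡ b mod 8)
               → kronecker a l ≡ kronecker b l
kronecker-cong zero      _   _       = refl
kronecker-cong l@(suc _) {a} {b} a≡b odd⇒a≡b = kronF-cong agree-at-divisors l l ℕ.∣-refl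
  where
  agree-at-divisors : ∀ q → q ℕ.∣ l → primeSym a q ≡ primeSym b q
  agree-at-divisors q q∣l = primeSym-cong q (mod-weaken q∣l a≡b) λ { refl → odd⇒a≡b q∣l }

-- discIndicator (divSq D f) is, definitionally, what indicator computes once f² ∣ D.
residueIndicator : ℕ → ℤ
residueIndicator r = if (r ≡ᵇ 0) ∨ (r ≡ᵇ 1) then 1ℤ else 0ℤ

discIndicator : ℤ → ℤ
discIndicator a = residueIndicator (a %ℕ 4)

discIndicator-cong : ∀ {a b} → a ≡ b mod 4 → discIndicator a ≡ discIndicator b
discIndicator-cong a≡b = cong residueIndicator (%ℕ-cong 4 a≡b)

discIndicator-square : ∀ {a} m → a ≡ m * m mod 4 → discIndicator a ≡ 1ℤ
discIndicator-square m a≡m² with square-mod4 m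
... | inj₁ m²≡0 = discIndicator-cong (mod-trans a≡m² m²≡0)
... | inj₂ m²≡1 = discIndicator-cong (mod-trans a≡m² m²≡1)

module _ {δ F : ℤ} (δ≡0 : δ ≡ 0ℤ mod 4) (a m : ℤ) (aF≡m²+δ : a * F ≡ m * m + δ) where

  unit-conductor⇒a≡m² : F ≡ 1ℤ mod 4 → a ≡ m * m mod 4
  unit-conductor⇒a≡m² F≡1 = begin
    a            ≡⟨ *-identityʳ a ⟨
    a * 1ℤ       ≈⟨ *-cong-mod (mod-refl a) F≡1 ⟨
    a * F        ≡⟨ aF≡m²+δ ⟩
    m * m + δ    ≈⟨ +-cong-mod (mod-refl (m * m)) δ≡0 ⟩
    m * m + 0ℤ   ≡⟨ +-identityʳ (m * m) ⟩
    m * m        ∎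
    where open ModReasoning 4

  even-conductor⇒m-even : F ≡ 0ℤ mod 4 → m ≡ 0ℤ mod 2
  even-conductor⇒m-even F≡0 with parity m
  ... | inj₁ m≡0 = m≡0
  ... | inj₂ m≡1 = ⊥-elim (1≢0-mod4 (begin
    1ℤ           ≈⟨ odd-square m≡1 ⟨
    m * m        ≡⟨ +-identityʳ (m * m) ⟨
    m * m + 0ℤ   ≈⟨ +-cong-mod (mod-refl (m * m)) δ≡0 ⟨
    m * m + δ    ≡⟨ aF≡m²+δ ⟨
    a * F        ≈⟨ *-cong-mod (mod-refl a) F≡0 ⟩
    a * 0ℤ       ≡⟨ *-zeroʳ a ⟩
    0ℤ           ∎))
    where open ModReasoning 4

  odd-quotient⇒m≡F : a ≡ 1ℤ mod 2 → m ≡ F mod 2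
  odd-quotient⇒m≡F a≡1 = begin
    m            ≈⟨ square-mod2 m ⟨
    m * m        ≡⟨ +-identityʳ (m * m) ⟨
    m * m + 0ℤ   ≈⟨ +-cong-mod (mod-refl (m * m)) (mod-weaken (ℕ.divides 2 refl) δ≡0) ⟨
    m * m + δ    ≡⟨ aF≡m²+δ ⟨
    a * F        ≈⟨ *-cong-mod a≡1 (mod-refl F) ⟩
    1ℤ * F       ≡⟨ *-identityˡ F ⟩
    F            ∎
    where open ModReasoning 2

module SameConductor
  {δ : ℤ} (δ≡0 : δ ≡ 0ℤ mod 4) (F : ℤ) .{{_ : ℤ.NonZero F}} (l : ℕ) (c m₁ m₂ a₁ a₂ : ℤ)
  (a₁F≡m₁²+δ : a₁ * F ≡ m₁ * m₁ + δ) (a₂F≡m₂²+δ : a₂ * F ≡ m₂ * m₂ + δ)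
  (m₂≡m₁+clF : m₂ ≡ m₁ + c * (+ l * F))
  where

  quotient-difference : a₂ - a₁ ≡ c * + l * (m₁ + m₂)
  quotient-difference = *-cancelʳ-≡ (a₂ - a₁) (c * + l * (m₁ + m₂)) F (begin
    (a₂ - a₁) * F                         ≡⟨ solve (a₁ ∷ a₂ ∷ F ∷ []) ⟩
    a₂ * F - a₁ * F                       ≡⟨ cong₂ _-_ a₂F≡m₂²+δ a₁F≡m₁²+δ ⟩
    (m₂ * m₂ + δ) - (m₁ * m₁ + δ)         ≡⟨ solve (m₁ ∷ m₂ ∷ δ ∷ []) ⟩
    (m₂ - m₁) * (m₁ + m₂)                 ≡⟨ cong (λ x → (x - m₁) * (m₁ + m₂)) m₂≡m₁+clF ⟩
    (m₁ + c * (+ l * F) - m₁) * (m₁ + m₂) ≡⟨ regroup m₁ m₂ c (+ l) F ⟩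
    c * + l * (m₁ + m₂) * F               ∎)
    where
    open ≡-Reasoning
    regroup : ∀ m₁ m₂ c L F → (m₁ + c * (L * F) - m₁) * (m₁ + m₂) ≡ c * L * (m₁ + m₂) * F
    regroup = solve-∀

  quotients-mod : ∀ {n} → c * + l * (m₁ + m₂) ≡ 0ℤ mod n → a₁ ≡ a₂ mod n
  quotients-mod {n} (∣⇒mod n∣) =
    mod-sym (∣⇒mod (subst (+ n ∣_) (trans (+-identityʳ _) (sym quotient-difference)) n∣))

  quotients-mod-l : a₁ ≡ a₂ mod l
  quotients-mod-l = quotients-mod (begin
    c * + l * (m₁ + m₂)   ≡⟨ swap c (+ l) (m₁ + m₂) ⟩
    c * (m₁ + m₂) * + l   ≈⟨ multiple≡0 (c * (m₁ + m₂)) ⟩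
    0ℤ                    ∎)
    where
    open ModReasoning l
    swap : ∀ c L w → c * L * w ≡ c * w * L
    swap = solve-∀

  indicators-agree : F ≡ 0ℤ mod 4 ⊎ F ≡ 1ℤ mod 4 → discIndicator a₁ ≡ discIndicator a₂
  indicators-agree (inj₂ F≡1) =
    trans (discIndicator-square m₁ (unit-conductor⇒a≡m² δ≡0 a₁ m₁ a₁F≡m₁²+δ F≡1))
          (sym (discIndicator-square m₂ (unit-conductor⇒a≡m² δ≡0 a₂ m₂ a₂F≡m₂²+δ F≡1)))
  indicators-agree (inj₁ F≡0) = discIndicator-cong (quotients-mod (begin
    c * + l * (m₁ + m₂)                    ≡⟨ cong (λ x → c * + l * (m₁ + x)) m₂≡m₁+clF ⟩
    c * + l * (m₁ + (m₁ + c * (+ l * F)))  ≡⟨ regroup c (+ l) F m₁ ⟩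
    c * + l * (+ 2 * m₁ + c * (+ l * F))   ≈⟨ *-cong-mod (mod-refl (c * + l)) (+-cong-mod
                                                (*-scale-mod 2 (even-conductor⇒m-even δ≡0 a₁ m₁ a₁F≡m₁²+δ F≡0))
                                                (*-cong-mod (mod-refl c) (*-cong-mod (mod-refl (+ l)) F≡0))) ⟩
    c * + l * (+ 2 * 0ℤ + c * (+ l * 0ℤ))  ≡⟨ vanish c (+ l) ⟩
    0ℤ                                     ∎))
    where
    open ModReasoning 4
    regroup : ∀ c L F m → c * L * (m + (m + c * (L * F))) ≡ c * L * (+ 2 * m + c * (L * F))
    regroup = solve-∀
    vanish : ∀ c L → c * L * (+ 2 * 0ℤ + c * (L * 0ℤ)) ≡ 0ℤ
    vanish = solve-∀

  quotients-mod8 : 2 ℕ.∣ l → a₁ ≡ 1ℤ mod 2 → a₁ ≡ a₂ mod 8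
  quotients-mod8 (ℕ.divides l′ l≡l′*2) a₁≡1 = quotients-mod (begin
    c * + l * (m₁ + m₂)                                   ≡⟨ cong (λ x → c * + l * (m₁ + x)) m₂≡m₁+clF ⟩
    c * + l * (m₁ + (m₁ + c * (+ l * F)))                 ≡⟨ cong (λ L → c * L * (m₁ + (m₁ + c * (L * F)))) +l≡+l′*2 ⟩
    c * (+ l′ * + 2) * (m₁ + (m₁ + c * ((+ l′ * + 2) * F))) ≡⟨ regroup c (+ l′) F m₁ ⟩
    + 4 * (c * + l′ * (m₁ + c * + l′ * F))                ≈⟨ *-scale-mod 4 (product-even (c * + l′) m₁≡F) ⟩
    0ℤ                                                    ∎)
    where
    open ModReasoning 8
    +l≡+l′*2 : + l ≡ + l′ * + 2
    +l≡+l′*2 = trans (cong +_ l≡l′*2) (pos-* l′ 2)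
    m₁≡F : m₁ ≡ F mod 2
    m₁≡F = odd-quotient⇒m≡F δ≡0 a₁ m₁ a₁F≡m₁²+δ a₁≡1
    regroup : ∀ c L F m → c * (L * + 2) * (m + (m + c * ((L * + 2) * F))) ≡ + 4 * (c * L * (m + c * L * F))
    regroup = solve-∀

offset : PM → ℕ → ℕ → ℤ
offset minus p k = - + (4 ℕ.* p ℕ.^ k)
offset plus  p k = + (4 ℕ.* p ℕ.^ k)

disc≡square+offset : ∀ s p k m → disc s p k m ≡ m * m + offset s p k
disc≡square+offset minus p k m = refl
disc≡square+offset plus  p k m = refl

offset≡0-mod4 : ∀ s p k → offset s p k ≡ 0ℤ mod 4
offset≡0-mod4 minus p k = neg-cong-mod (offset≡0-mod4 plus p k)
offset≡0-mod4 plus  p k = ∣⇒≡0-mod (∣ᵤ⇒∣ (ℕ.m∣m*n (p ℕ.^ k)))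

disc-cong : ∀ s p k {n m₁ m₂} → m₁ ≡ m₂ mod n → disc s p k m₁ ≡ disc s p k m₂ mod n
disc-cong s p k {n} {m₁} {m₂} m₁≡m₂ = begin
  disc s p k m₁             ≡⟨ disc≡square+offset s p k m₁ ⟩
  m₁ * m₁ + offset s p k    ≈⟨ +-cong-mod (*-cong-mod m₁≡m₂ m₁≡m₂) (mod-refl (offset s p k)) ⟩
  m₂ * m₂ + offset s p k    ≡⟨ disc≡square+offset s p k m₂ ⟨
  disc s p k m₂             ∎
  where open ModReasoning n

divSq-exact : ∀ D f .{{_ : NonZero f}} → + (f ℕ.* f) Unsigned.∣ D → divSq D f * + (f ℕ.* f) ≡ D
divSq-exact D f@(suc _) F∣D = sym (begin
  D                         ≡⟨ a≡a%ℕn+[a/ℕn]*n D F ⟩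
  + (D %ℕ F) + D /ℕ F * + F ≡⟨ cong (λ r → + r + D /ℕ F * + F) (%ℕ-cong F (∣⇒≡0-mod (∣ᵤ⇒∣ {+ F} {D} F∣D))) ⟩
  0ℤ + D /ℕ F * + F         ≡⟨ +-identityˡ _ ⟩
  D /ℕ F * + F              ∎)
  where
  open ≡-Reasoning
  F : ℕ
  F = f ℕ.* f

indicator-divisible : ∀ s p k f m → + (f ℕ.* f) Unsigned.∣ disc s p k m
                    → indicator s p k f m ≡ discIndicator (divSq (disc s p k m) f)
indicator-divisible s p k f m F∣D with (+ (f ℕ.* f)) ∣ℤ? disc s p k m
... | yes _   = refl
... | no  F∤D = ⊥-elim (F∤D F∣D)

term-divisible : ∀ s p k f l m → + (f ℕ.* f) Unsigned.∣ disc s p k m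
               → term s p k f l m ≡ discIndicator (divSq (disc s p k m) f) * kronecker (divSq (disc s p k m) f) l
term-divisible s p k f l m F∣D with (+ (f ℕ.* f)) ∣ℤ? disc s p k m
... | yes _   = cong (_* kronecker (divSq (disc s p k m) f) l) (indicator-divisible s p k f m F∣D)
... | no  F∤D = ⊥-elim (F∤D F∣D)

term-indivisible : ∀ s p k f l m → ¬ (+ (f ℕ.* f) Unsigned.∣ disc s p k m) → term s p k f l m ≡ 0ℤ
term-indivisible s p k f l m F∤D with (+ (f ℕ.* f)) ∣ℤ? disc s p k m
... | yes F∣D = ⊥-elim (F∤D F∣D)
... | no  _   = refl

square≡0∨1-mod4 : ∀ f → + (f ℕ.* f) ≡ 0ℤ mod 4 ⊎ + (f ℕ.* f) ≡ 1ℤ mod 4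
square≡0∨1-mod4 f = subst (λ F → F ≡ 0ℤ mod 4 ⊎ F ≡ 1ℤ mod 4) (sym (pos-* f f)) (square-mod4 (+ f))

quotient-equation : ∀ s p k f m .{{_ : NonZero f}} → + (f ℕ.* f) Unsigned.∣ disc s p k m
                  → divSq (disc s p k m) f * + (f ℕ.* f) ≡ m * m + offset s p k
quotient-equation s p k f m F∣D = trans (divSq-exact (disc s p k m) f F∣D) (disc≡square+offset s p k m)

mod⇒multiple-of-product : ∀ {m₁ m₂} l F → m₁ ≡ m₂ mod (l ℕ.* F) → Σ ℤ λ c → m₂ ≡ m₁ + c * (+ l * + F)
mod⇒multiple-of-product {m₁} {m₂} l F m₁≡m₂ with mod⇒multiple (mod-sym m₁≡m₂)
... | c , m₂≡m₁+clF = c , subst (λ x → m₂ ≡ m₁ + c * x) (pos-* l F) m₂≡m₁+clF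

conductor-divides-cong : ∀ s p k f l {m₁ m₂} → m₁ ≡ m₂ mod (l ℕ.* (f ℕ.* f))
                       → + (f ℕ.* f) Unsigned.∣ disc s p k m₁ → + (f ℕ.* f) Unsigned.∣ disc s p k m₂
conductor-divides-cong s p k f l m₁≡m₂ = ∣-resp-mod (disc-cong s p k (mod-weaken (ℕ.n∣m*n l) m₁≡m₂))

mainTheorem8 : (p : ℕ) → Prime p → (k : ℕ) → (s : PM)
    → (f l : ℕ) → .{{_ : NonZero f}} → .{{_ : NonZero l}}
    → (m₁ m₂ : ℤ) → (+ (l ℕ.* (f ℕ.* f))) Unsigned.∣ (m₁ - m₂)
    → term s p k f l m₁ ≡ term s p k f l m₂
mainTheorem8 p _ k s f@(suc _) l m₁ m₂ lf²∣m₁-m₂ =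
  by-divisibility ((+ (f ℕ.* f)) ∣ℤ? disc s p k m₁) ((+ (f ℕ.* f)) ∣ℤ? disc s p k m₂)
  where
  m₁≡m₂ : m₁ ≡ m₂ mod (l ℕ.* (f ℕ.* f))
  m₁≡m₂ = ∣ᵤ⇒mod m₁ m₂ lf²∣m₁-m₂

  -- Splitting with `with` would also abstract the divisibility tests inside term.
  by-divisibility : Dec (+ (f ℕ.* f) Unsigned.∣ disc s p k m₁) → Dec (+ (f ℕ.* f) Unsigned.∣ disc s p k m₂)
                  → term s p k f l m₁ ≡ term s p k f l m₂
  by-divisibility (yes F∣D₁) (yes F∣D₂) = begin
    term s p k f l m₁                   ≡⟨ term-divisible s p k f l m₁ F∣D₁ ⟩
    discIndicator a₁ * kronecker a₁ l   ≡⟨ cong₂ _*_ (indicators-agree (square≡0∨1-mod4 f))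
                                                     (kronecker-cong l quotients-mod-l quotients-mod8) ⟩
    discIndicator a₂ * kronecker a₂ l   ≡⟨ term-divisible s p k f l m₂ F∣D₂ ⟨
    term s p k f l m₂                   ∎
    where
    open ≡-Reasoning
    a₁ a₂ : ℤ
    a₁ = divSq (disc s p k m₁) f
    a₂ = divSq (disc s p k m₂) f
    m₂≡m₁+clf² : Σ ℤ λ c → m₂ ≡ m₁ + c * (+ l * + (f ℕ.* f))
    m₂≡m₁+clf² = mod⇒multiple-of-product l (f ℕ.* f) m₁≡m₂
    open SameConductor (offset≡0-mod4 s p k) (+ (f ℕ.* f)) l (proj₁ m₂≡m₁+clf²) m₁ m₂ a₁ a₂
      (quotient-equation s p k f m₁ F∣D₁) (quotient-equation s p k f m₂ F∣D₂) (proj₂ m₂≡m₁+clf²)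
  by-divisibility (no F∤D₁)  (no F∤D₂)  =
    trans (term-indivisible s p k f l m₁ F∤D₁) (sym (term-indivisible s p k f l m₂ F∤D₂))
  by-divisibility (yes F∣D₁) (no F∤D₂)  = ⊥-elim (F∤D₂ (conductor-divides-cong s p k f l m₁≡m₂ F∣D₁))
  by-divisibility (no F∤D₁)  (yes F∣D₂) = ⊥-elim (F∤D₁ (conductor-divides-cong s p k f l (mod-sym m₁≡m₂) F∣D₂))
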